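{- Let $A$ be a non-empty set of atoms. (1) For any $\mathsf T$-term $P$, $se(P)$ contains a leaf $\mathsf T$ but no leaf $\mathsf F$. (2) For any $\mathsf F$-term $P$, $se(P)$ contains a leaf $\mathsf F$ but no leaf $\mathsf T$. (3) For any $*$-term $P$, $se(P)$ contains both $\mathsf T$ and $\mathsf F$.
   Context: Closed terms over constants $\mathsf T,\mathsf F$, atoms $a\in A$, unary $\neg$ and binary $\wedge,\vee$ (left-sequential connectives). The term classes are given by the grammar (with $a\in A$): $\mathsf T$-terms: $P^{\mathsf T}::=\mathsf T\mid (a\wedge P^{\mathsf T})\vee P^{\mathsf T}$; $\mathsf F$-terms: $P^{\mathsf F}::=\mathsf F\mid (a\vee P^{\mathsf F})\wedge P^{\mathsf F}$; $\ell$-terms: $P^\ell::=(a\wedge P^{\mathsf T})\vee P^{\mathsf F}\mid(\neg a\wedge P^{\mathsf T})\vee P^{\mathsf F}$; $*$-terms: $P^*::=P^c\mid P^d$, where $P^c::=P^\ell\mid P^*\wedge P^d$ and $P^d::=P^\ell\mid P^*\vee P^c$. Evaluation trees: $\mathcal T_A$ is the least set containing $\mathsf T,\mathsf F$ and all $X\trianglelefteq a\trianglerighteq Y$ (root $a$, left branch $X$, right branch $Y$). $X[\mathsf T\mapsto Y,\mathsf F\mapsto Z]$ replaces each $\mathsf T$-leaf by $Y$ and each $\mathsf F$-leaf by $Z$ (unlisted leaves unchanged). $se(\mathsf T)=\mathsf T$, $se(\mathsf F)=\mathsf F$, $se(a)=\mathsf T\trianglelefteq a\trianglerighteq\mathsf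 F$, $se(\neg P)=se(P)[\mathsf T\mapsto\mathsf F,\mathsf F\mapsto\mathsf T]$, $se(P\wedge Q)=se(P)[\mathsf T\mapsto se(Q)]$, $se(P\vee Q)=se(P)[\mathsf F\mapsto se(Q)]$. -}

module Defs where

open import Data.Product using (_×_)

data Term (A : Set) : Set where
  `T   : Term A
  `F   : Term A
  atom : A → Term A
  `¬_  : Term A → Term A
  _`∧_ : Term A → Term A → Term A
  _`∨_ : Term A → Term A → Term A

data TTerm {A : Set} : Term A → Set where
  T-base : TTerm `T
  T-step : ∀ {a P Q} → TTerm P → TTerm Q → TTerm ((atom a `∧ P) `∨ Q)

data FTerm {A : Set} : Term A → Set where
  F-base : FTerm `F
  F-step : ∀ {a P Q} → FTerm P → FTerm Q → FTerm ((atom a `∨ P) `∧ Q)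

data ℓTerm {A : Set} : Term A → Set where
  ℓ-pos : ∀ {a P Q} → TTerm P → FTerm Q → ℓTerm ((atom a `∧ P) `∨ Q)
  ℓ-neg : ∀ {a P Q} → TTerm P → FTerm Q → ℓTerm (((`¬ atom a) `∧ P) `∨ Q)

data StarTerm {A : Set} : Term A → Set
data CTerm {A : Set} : Term A → Set
data DTerm {A : Set} : Term A → Set

data StarTerm {A} where
  star-c : ∀ {P} → CTerm P → StarTerm P
  star-d : ∀ {P} → DTerm P → StarTerm P

data CTerm {A} where
  c-ℓ : ∀ {P} → ℓTerm P → CTerm P
  c-∧ : ∀ {P Q} → StarTerm P → DTerm Q → CTerm (P `∧ Q)

data DTerm {A} where
  d-ℓ : ∀ {P} → ℓTerm P → DTerm P
  d-∨ : ∀ {P Q} → StarTerm P → CTerm Q → DTerm (P `∨ Q)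

-- Evaluation trees: leaves T, F, and nodes X ⊴ a ⊵ Y.
data Tree (A : Set) : Set where
  leafT : Tree A
  leafF : Tree A
  node  : Tree A → A → Tree A → Tree A

replace : {A : Set} → Tree A → Tree A → Tree A → Tree A
replace leafT        Y Z = Y
replace leafF        Y Z = Z
replace (node X a W) Y Z = node (replace X Y Z) a (replace W Y Z)

se : {A : Set} → Term A → Tree A
se `T       = leafT
se `F       = leafF
se (atom a) = node leafT a leafF
se (`¬ P)   = replace (se P) leafF leafT
se (P `∧ Q) = replace (se P) (se Q) leafF
se (P `∨ Q) = replace (se P) leafT (se Q)

data HasT {A : Set} : Tree A → Set where
  here  : HasT leafT
  left  : ∀ {X a Y} → HasT X → HasT (node X a Y)
  right : ∀ {X a Y} → HasT Y → HasT (node X a Y)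

data HasF {A : Set} : Tree A → Set where
  here  : HasF leafF
  left  : ∀ {X a Y} → HasF X → HasF (node X a Y)
  right : ∀ {X a Y} → HasF Y → HasF (node X a Y)

module Submission where

open import Defs
open import Data.Product using (_×_; _,_)
open import Relation.Nullary using (¬_)

-- se(P ∧ Q) and se(P ∨ Q) graft se Q onto the T- resp. F-leaves of se P, so a
-- leaf of the result comes either from se P directly or from se Q through a
-- matching leaf of se P; and a leaf kind absent from everything grafted is
-- absent from the result, whatever se P looks like.

module _ {A : Set} where

  HasT-replaceᵀ : ∀ {X Y Z : Tree A} → HasT X → HasT Y → HasT (replace X Y Z)
  HasT-replaceᵀ here      y = y
  HasT-replaceᵀ (left x)  y = left (HasT-replaceᵀ x y)
  HasT-replaceᵀ (right x) y = right (HasT-replaceᵀ x y)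

  HasF-replaceᵀ : ∀ {X Y Z : Tree A} → HasT X → HasF Y → HasF (replace X Y Z)
  HasF-replaceᵀ here      y = y
  HasF-replaceᵀ (left x)  y = left (HasF-replaceᵀ x y)
  HasF-replaceᵀ (right x) y = right (HasF-replaceᵀ x y)

  HasF-replaceᶠ : ∀ {X Y Z : Tree A} → HasF X → HasF Z → HasF (replace X Y Z)
  HasF-replaceᶠ here      z = z
  HasF-replaceᶠ (left x)  z = left (HasF-replaceᶠ x z)
  HasF-replaceᶠ (right x) z = right (HasF-replaceᶠ x z)

  ¬HasT-replace : ∀ (X : Tree A) {Y Z} → ¬ HasT Y → ¬ HasT Z → ¬ HasT (replace X Y Z)
  ¬HasT-replace leafT        ¬y ¬z t         = ¬y t
  ¬HasT-replace leafF        ¬y ¬z t         = ¬z t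
  ¬HasT-replace (node X a W) ¬y ¬z (left t)  = ¬HasT-replace X ¬y ¬z t
  ¬HasT-replace (node X a W) ¬y ¬z (right t) = ¬HasT-replace W ¬y ¬z t

  ¬HasF-replace : ∀ (X : Tree A) {Y Z} → ¬ HasF Y → ¬ HasF Z → ¬ HasF (replace X Y Z)
  ¬HasF-replace leafT        ¬y ¬z f         = ¬y f
  ¬HasF-replace leafF        ¬y ¬z f         = ¬z f
  ¬HasF-replace (node X a W) ¬y ¬z (left f)  = ¬HasF-replace X ¬y ¬z f
  ¬HasF-replace (node X a W) ¬y ¬z (right f) = ¬HasF-replace W ¬y ¬z f

  HasT-se-guarded : ∀ (L P Q : Term A) →
    HasT (se L) → HasT (se P) → HasT (se ((L `∧ P) `∨ Q))
  HasT-se-guarded L P _ l p =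
    HasT-replaceᵀ {X = se (L `∧ P)} (HasT-replaceᵀ {X = se L} l p) here

  HasF-se-guarded : ∀ (L P Q : Term A) →
    HasF (se L) → HasF (se Q) → HasF (se ((L `∧ P) `∨ Q))
  HasF-se-guarded L P _ l q =
    HasF-replaceᶠ {X = se (L `∧ P)} (HasF-replaceᶠ {X = se L} l here) q

  TTerm-leaves : ∀ {P : Term A} → TTerm P → HasT (se P) × ¬ HasF (se P)
  TTerm-leaves T-base = here , λ ()
  TTerm-leaves (T-step {a} {P} {Q} p q) with TTerm-leaves p | TTerm-leaves q
  ... | hasT , _ | _ , ¬hasF =
    HasT-se-guarded (atom a) P Q (left here) hasT , ¬HasF-replace (se (atom a `∧ P)) (λ ()) ¬hasF

  FTerm-leaves : ∀ {P : Term A} → FTerm P → HasF (se P) × ¬ HasT (se P)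
  FTerm-leaves F-base = here , λ ()
  FTerm-leaves (F-step {a} {P} p q) with FTerm-leaves p | FTerm-leaves q
  ... | hasF , _ | _ , ¬hasT =
    HasF-replaceᶠ {X = se (atom a `∨ P)} (HasF-replaceᶠ {X = se (atom a)} (right here) hasF) here
    , ¬HasT-replace (se (atom a `∨ P)) ¬hasT (λ ())

  ℓTerm-leaves : ∀ {P : Term A} → ℓTerm P → HasT (se P) × HasF (se P)
  ℓTerm-leaves (ℓ-pos {a} {P} {Q} p q) with TTerm-leaves p | FTerm-leaves q
  ... | hasT , _ | hasF , _ =
    HasT-se-guarded (atom a) P Q (left here) hasT , HasF-se-guarded (atom a) P Q (right here) hasF
  ℓTerm-leaves (ℓ-neg {a} {P} {Q} p q) with TTerm-leaves p | FTerm-leaves q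
  ... | hasT , _ | hasF , _ =
    HasT-se-guarded (`¬ atom a) P Q (right here) hasT , HasF-se-guarded (`¬ atom a) P Q (left here) hasF

  StarTerm-leaves : ∀ {P : Term A} → StarTerm P → HasT (se P) × HasF (se P)
  CTerm-leaves    : ∀ {P : Term A} → CTerm P → HasT (se P) × HasF (se P)
  DTerm-leaves    : ∀ {P : Term A} → DTerm P → HasT (se P) × HasF (se P)

  StarTerm-leaves (star-c c) = CTerm-leaves c
  StarTerm-leaves (star-d d) = DTerm-leaves d

  CTerm-leaves (c-ℓ l) = ℓTerm-leaves l
  CTerm-leaves (c-∧ {P} p q) with StarTerm-leaves p | DTerm-leaves q
  ... | hasT , hasF | hasT′ , _ = HasT-replaceᵀ {X = se P} hasT hasT′ , HasF-replaceᶠ {X = se P} hasF here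

  DTerm-leaves (d-ℓ l) = ℓTerm-leaves l
  DTerm-leaves (d-∨ {P} p q) with StarTerm-leaves p | CTerm-leaves q
  ... | hasT , hasF | _ , hasF′ = HasT-replaceᵀ {X = se P} hasT here , HasF-replaceᶠ {X = se P} hasF hasF′

lemma3p1 : (A : Set) → A →
    ((P : Term A) → TTerm P → HasT (se P) × ¬ HasF (se P))
    × ((P : Term A) → FTerm P → HasF (se P) × ¬ HasT (se P))
    × ((P : Term A) → StarTerm P → HasT (se P) × HasF (se P))
lemma3p1 A _ = (λ _ → TTerm-leaves) , (λ _ → FTerm-leaves) , (λ _ → StarTerm-leaves)
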